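{- ($\mathbf{PRS\omega}$) If $T$ is a class-sized dilator, then its restriction $T\restriction\mathbb N$ to the category of natural numbers is a set-sized dilator.
   Context: $\mathbf{PRS\omega}$ is primitive recursive set theory with infinity. Linear orders form a category with order embeddings as morphisms; $[X]^{<\omega}$ is the set of finite subsets of $X$, $[f]^{<\omega}(a)=\{f(s)\mid s\in a\}$. A class-sized prae-dilator is an endofunctor $T$ of linear orders with a natural transformation $\operatorname{supp}^T:T\Rightarrow[\cdot]^{<\omega}$ such that each $\sigma\in T_X$ lies in the range of $T_\iota$ with $\iota:\operatorname{supp}^T_X(\sigma)\hookrightarrow X$ the inclusion; it is a class-sized dilator if $T_X$ is well-founded for every well-order $X$. The category of natural numbers has objects $n=\{0,\dots,n-1\}$ and order embeddings as morphisms. For a finite linear order $a$, $|a|$ is its cardinality, $\operatorname{en}_a:|a|\rightarrow a$ the order isomorphism, $\iota_c^d$ the inclusion for $c\subseteq d$, and $|\iota_c^d|:|c|\rightarrow|d|$ the order preserving map with $\operatorname{en}_d\circ|\iota_c^d|=\iota_c^d\circ\operatorname{en}_c$. A set-sized prae-dilator is a functor $S$ from the category of natural numbers to linear orders with a natural transformation $\operatorname{supp}^S:S\Rightarrow[\cdot]^{<\omega}$ such that each $\sigma\in S_n$ lies in the range of $S_{\iota_a^n\circ\operatorname{en}_a}$, $a=\operatorname{supp}^S_n(\sigma)$. For such $S$ and a linear order $X$, $D^S_X=\{\langle a,\sigma\rangle\mid a\in[X]^{<\omega},\sigma\in S_{|a|},\operatorname{supp}^S_{|a|}(\sigma)=|a|\}$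 with $\langle a,\sigma\rangle<\langle b,\tau\rangle$ iff $S_{|\iota_a^{a\cup b}|}(\sigma)<_{S_{|a\cup b|}}S_{|\iota_b^{a\cup b}|}(\tau)$. $S$ is a set-sized dilator if $D^S_X$ is well-founded for every well-order $X$. -}

module Defs where

open import Level using (0ℓ)
open import Data.Nat using (ℕ; zero; suc; s≤s)
open import Data.Fin as Fin using (Fin; zero; suc)
import Data.Fin.Properties as FinP
open import Data.List using (List; []; _∷_; length; lookup; map; allFin)
open import Data.List.Relation.Unary.Linked using (Linked; []; [-]; _∷_)
open import Data.Product using (Σ; _,_; proj₁; proj₂; ∃; _×_)
open import Relation.Binary using (Rel; IsStrictTotalOrder; Tri; tri<; tri≈; tri>)
open import Relation.Binary.PropositionalEquality using (_≡_; refl)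
open import Induction.WellFounded using (WellFounded)

record LinOrd : Set₁ where
  field
    Carrier : Set
    _<_     : Rel Carrier 0ℓ
    isSTO   : IsStrictTotalOrder _≡_ _<_
  open IsStrictTotalOrder isSTO public using (compare; trans)

open LinOrd public using (Carrier)

IsWellOrder : LinOrd → Set
IsWellOrder X = WellFounded (LinOrd._<_ X)

record Emb (X Y : LinOrd) : Set where
  private
    module X = LinOrd X
    module Y = LinOrd Y
  field
    fun  : X.Carrier → Y.Carrier
    mono : ∀ {x y} → x X.< y → fun x Y.< fun y

open Emb public

idE : (X : LinOrd) → Emb X X
idE X = record { fun = λ x → x ; mono = λ p → p }

_∘E_ : ∀ {X Y Z} → Emb Y Z → Emb X Y → Emb X Z
g ∘E f = record { fun = λ x → fun g (fun f x) ; mono = λ p → mono g (mono f p) }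

FinOrd : ℕ → LinOrd
FinOrd n = record { Carrier = Fin n ; _<_ = Fin._<_ ; isSTO = FinP.<-isStrictTotalOrder }

-- Finite subsets [X]^{<ω}, represented canonically as strictly
-- increasing lists (the increasing enumeration of the subset).

FinSub : LinOrd → Set
FinSub X = Σ (List (Carrier X)) (Linked (LinOrd._<_ X))

module _ (X : LinOrd) where
  open LinOrd X hiding (Carrier)

  private
    tailL : ∀ {x xs} → Linked _<_ (x ∷ xs) → Linked _<_ xs
    tailL [-] = []
    tailL (_ ∷ l) = l

    head< : ∀ {x xs} → Linked _<_ (x ∷ xs) → (j : Fin (length xs)) → x < lookup xs j
    head< (x<y ∷ l) zero = x<y
    head< (x<y ∷ l) (suc j) = trans x<y (head< l j)

  lookup-mono : ∀ {xs} → Linked _<_ xs → ∀ {i j : Fin (length xs)} →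
                i Fin.< j → lookup xs i < lookup xs j
  lookup-mono {x ∷ xs} l {zero} {suc j} _ = head< l j
  lookup-mono {x ∷ xs} l {suc i} {suc j} (s≤s i<j) = lookup-mono (tailL l) i<j

  -- for a finite subset a of X: the map ι_a ∘ en_a : |a| → X,
  -- i.e. the inclusion of a into X, precomposed with the order
  -- isomorphism en_a : |a| → a
  incl : (a : FinSub X) → Emb (FinOrd (length (proj₁ a))) X
  incl a = record { fun = lookup (proj₁ a) ; mono = lookup-mono (proj₂ a) }

  infixr 6 _∪_
  _∪_ : List (Carrier X) → List (Carrier X) → List (Carrier X)
  [] ∪ ys = ys
  (x ∷ xs) ∪ ys = go ys
    where
    go : List (Carrier X) → List (Carrier X)
    go [] = x ∷ xs
    go (y ∷ ys') with compare x y
    ... | tri< _ _ _ = x ∷ (xs ∪ (y ∷ ys'))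
    ... | tri≈ _ _ _ = x ∷ (xs ∪ ys')
    ... | tri> _ _ _ = y ∷ go ys'

record ClassPraeDilator : Set₁ where
  field
    obj      : LinOrd → LinOrd
    mor      : ∀ {X Y} → Emb X Y → Emb (obj X) (obj Y)
    mor-cong : ∀ {X Y} (f g : Emb X Y) → (∀ x → fun f x ≡ fun g x) →
               ∀ σ → fun (mor f) σ ≡ fun (mor g) σ
    mor-id   : ∀ {X} σ → fun (mor (idE X)) σ ≡ σ
    mor-∘    : ∀ {X Y Z} (g : Emb Y Z) (f : Emb X Y) σ →
               fun (mor (g ∘E f)) σ ≡ fun (mor g) (fun (mor f) σ)
    supp     : ∀ X → Carrier (obj X) → FinSub X
    supp-nat : ∀ {X Y} (f : Emb X Y) σ →
               proj₁ (supp Y (fun (mor f) σ)) ≡ map (fun f) (proj₁ (supp X σ))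
    supp-gen : ∀ X σ → ∃ λ τ → fun (mor (incl X (supp X σ))) τ ≡ σ

IsClassDilator : ClassPraeDilator → Set₁
IsClassDilator T = ∀ X → IsWellOrder X → IsWellOrder (ClassPraeDilator.obj T X)

record SetPraeDilator : Set₁ where
  field
    obj      : ℕ → LinOrd
    mor      : ∀ {m n} → Emb (FinOrd m) (FinOrd n) → Emb (obj m) (obj n)
    mor-cong : ∀ {m n} (f g : Emb (FinOrd m) (FinOrd n)) → (∀ x → fun f x ≡ fun g x) →
               ∀ σ → fun (mor f) σ ≡ fun (mor g) σ
    mor-id   : ∀ {n} σ → fun (mor (idE (FinOrd n))) σ ≡ σ
    mor-∘    : ∀ {k m n} (g : Emb (FinOrd m) (FinOrd n)) (f : Emb (FinOrd k) (FinOrd m)) σ →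
               fun (mor (g ∘E f)) σ ≡ fun (mor g) (fun (mor f) σ)
    supp     : ∀ n → Carrier (obj n) → FinSub (FinOrd n)
    supp-nat : ∀ {m n} (f : Emb (FinOrd m) (FinOrd n)) σ →
               proj₁ (supp n (fun (mor f) σ)) ≡ map (fun f) (proj₁ (supp m σ))
    supp-gen : ∀ n σ → ∃ λ τ → fun (mor (incl (FinOrd n) (supp n σ))) τ ≡ σ

module _ (S : SetPraeDilator) (X : LinOrd) where
  open SetPraeDilator S

  private
    ∣_∣ : FinSub X → ℕ
    ∣ a ∣ = length (proj₁ a)

  DCarrier : Set
  DCarrier = Σ (FinSub X) λ a → Σ (Carrier (obj ∣ a ∣)) λ σ →
               proj₁ (supp ∣ a ∣ σ) ≡ allFin ∣ a ∣

  -- |ι_c^d| : |c| → |d| is the (unique) order embedding with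
  -- en_d ∘ |ι_c^d| = ι_c^d ∘ en_c
  IsIotaBar : (c d : List (Carrier X)) → Emb (FinOrd (length c)) (FinOrd (length d)) → Set
  IsIotaBar c d e = ∀ i → lookup d (fun e i) ≡ lookup c i

  _<D_ : Rel DCarrier 0ℓ
  (a , σ , _) <D (b , τ , _) =
    let c = _∪_ X (proj₁ a) (proj₁ b) in
    Σ (Emb (FinOrd ∣ a ∣) (FinOrd (length c))) λ e₁ →
    Σ (Emb (FinOrd ∣ b ∣) (FinOrd (length c))) λ e₂ →
      IsIotaBar (proj₁ a) c e₁ × IsIotaBar (proj₁ b) c e₂ ×
      LinOrd._<_ (obj (length c)) (fun (mor e₁) σ) (fun (mor e₂) τ)

IsSetDilator : SetPraeDilator → Set₁
IsSetDilator S = ∀ X → IsWellOrder X → WellFounded (_<D_ S X)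

restrictℕ : ClassPraeDilator → SetPraeDilator
restrictℕ T = record
  { obj      = λ n → obj (FinOrd n)
  ; mor      = mor
  ; mor-cong = mor-cong
  ; mor-id   = λ {n} → mor-id {FinOrd n}
  ; mor-∘    = mor-∘
  ; supp     = λ n → supp (FinOrd n)
  ; supp-nat = supp-nat
  ; supp-gen = λ n → supp-gen (FinOrd n)
  }
  where open ClassPraeDilator T

module Submission where

-- For a class-sized prae-dilator T and a
-- linear order X, an element ⟨a,σ⟩ of D^{T↾ℕ}_X names the element
-- T_{ι_a ∘ en_a}(σ) of T_X.  This assignment is strictly order preserving:
-- if ⟨a,σ⟩ < ⟨b,τ⟩ is witnessed in T_{|a ∪ b|} by the embeddings |ι_a^{a∪b}|
-- and |ι_b^{a∪b}|, then applying T_{ι_{a∪b} ∘ en_{a∪b}} and functoriality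
-- (ι_{a∪b} ∘ en_{a∪b} ∘ |ι_a^{a∪b}| = ι_a ∘ en_a) turns it into the
-- inequality between the named elements of T_X.  A strictly monotone map
-- into a well-founded order reflects well-foundedness, so D^{T↾ℕ}_X is
-- well-founded whenever T_X is, in particular whenever X is a well-order.

open import Defs
open import Data.Maybe using (just)
open import Data.List using (List; []; _∷_; head)
open import Data.List.Relation.Unary.Linked using (Linked; []; _∷_; head′; _∷′_) renaming (tail to linked-tail)
open import Data.Maybe.Relation.Binary.Connected using (Connected; just)
open import Data.Product using (_,_)
open import Relation.Binary using (tri<; tri≈; tri>)
open import Relation.Binary.PropositionalEquality using (_≡_; refl; sym; trans; subst₂)
open import Induction.WellFounded using (module Subrelation)
import Relation.Binary.Construct.On as On

module IncreasingMerge (X : LinOrd) where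
  open LinOrd X hiding (Carrier)

  Below : Carrier X → List (Carrier X) → Set
  Below z xs = Connected _<_ (just z) (head xs)

  -- The head of a merge is the head of one of the two lists, so a common
  -- lower bound of both heads bounds the head of the merge.
  below-∪ : ∀ {z} xs ys → Below z xs → Below z ys → Below z (_∪_ X xs ys)
  below-∪ [] ys _ z<ys = z<ys
  below-∪ (x ∷ xs) [] z<xs _ = z<xs
  below-∪ (x ∷ xs) (y ∷ ys) z<xs z<ys with compare x y
  ... | tri< _ _ _ = z<xs
  ... | tri≈ _ _ _ = z<xs
  ... | tri> _ _ _ = z<ys

  -- The proof follows the recursion of the merge: `merge-increasing` keeps
  -- the first list x ∷ xs fixed and walks down the second one.
  ∪-increasing : ∀ xs ys → Linked _<_ xs → Linked _<_ ys → Linked _<_ (_∪_ X xs ys)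
  merge-increasing : ∀ x xs ys → Linked _<_ (x ∷ xs) → Linked _<_ ys →
                     Linked _<_ (_∪_ X (x ∷ xs) ys)

  ∪-increasing [] _ _ M = M
  ∪-increasing (x ∷ xs) ys L M = merge-increasing x xs ys L M

  merge-increasing x xs [] L _ = L
  merge-increasing x xs (y ∷ ys) L M with compare x y
  ... | tri< x<y _ _ =
    below-∪ xs (y ∷ ys) (head′ L) (just x<y) ∷′ ∪-increasing xs (y ∷ ys) (linked-tail L) M
  ... | tri≈ _ refl _ =
    below-∪ xs ys (head′ L) (head′ M) ∷′ ∪-increasing xs ys (linked-tail L) (linked-tail M)
  ... | tri> _ _ y<x =
    below-∪ (x ∷ xs) ys (just y<x) (head′ M) ∷′ merge-increasing x xs ys L (linked-tail M)

  _∪ₛ_ : FinSub X → FinSub X → FinSub X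
  (xs , L) ∪ₛ (ys , M) = _∪_ X xs ys , ∪-increasing xs ys L M

module _ (T : ClassPraeDilator) where
  open ClassPraeDilator T

  mor-triangle : ∀ {X Y Z} (e : Emb X Y) (g : Emb Y Z) (f : Emb X Z) →
                 (∀ x → fun g (fun e x) ≡ fun f x) →
                 ∀ σ → fun (mor f) σ ≡ fun (mor g) (fun (mor e) σ)
  mor-triangle e g f commutes σ =
    trans (mor-cong f (g ∘E e) (λ x → sym (commutes x)) σ) (mor-∘ g e σ)

  module _ (X : LinOrd) where
    open IncreasingMerge X

    denote : DCarrier (restrictℕ T) X → Carrier (obj X)
    denote (a , σ , _) = fun (mor (incl X a)) σ

    -- The denotation is strictly order preserving: push the comparison in
    -- T_{|a ∪ b|} forward along T_{ι_{a∪b} ∘ en_{a∪b}}.  The condition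
    -- IsIotaBar is exactly the commuting triangle needed for functoriality.
    denote-mono : ∀ {p q} → _<D_ (restrictℕ T) X p q →
                  LinOrd._<_ (obj X) (denote p) (denote q)
    denote-mono {a , σ , _} {b , τ , _} (e₁ , e₂ , triangle₁ , triangle₂ , σ<τ) =
      subst₂ (LinOrd._<_ (obj X))
        (sym (mor-triangle e₁ (incl X c) (incl X a) triangle₁ σ))
        (sym (mor-triangle e₂ (incl X c) (incl X b) triangle₂ τ))
        (mono (mor (incl X c)) σ<τ)
      where
      c : FinSub X
      c = a ∪ₛ b

corollary2p8 : (T : ClassPraeDilator) → IsClassDilator T → IsSetDilator (restrictℕ T)
corollary2p8 T isDilator X isWellOrder =
  Subrelation.wellFounded (λ {p} {q} → denote-mono T X {p} {q})
    (On.wellFounded (denote T X) (isDilator X isWellOrder))
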